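{- Let $a<b$ be relatively prime positive integers with $a\neq 1$, and let $\mathcal{U}=\mathcal{U}(a,b)$. If $2\leqslant k\leqslant b$ and $2\leqslant l\leqslant a$ are integers, then $ka\notin\mathcal{U}$ and $lb\notin\mathcal{U}$.
   Context: For positive integers $a<b$, the Ulam sequence $\mathcal{U}(a,b)$ has first terms $a,b$, and each subsequent term is the smallest integer larger than all previous terms that can be written as the sum of two distinct earlier terms in exactly one way (unordered pairs). The sequence is identified with its set of terms. -}

module Defs where

open import Data.Nat using (ℕ; zero; suc; _+_; _<_; _<ᵇ_; _≡ᵇ_)
open import Data.Bool using (Bool; true; false; if_then_else_; _∧_; _∨_)
open import Data.List using (List; []; _∷_; _++_; length; filter; concatMap; [_])
open import Data.List.Membership.Propositional using (_∈_)

-- number of unordered pairs {x , y} with x < y, both in xs, and x + y ≡ n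
-- (xs is duplicate-free in our use)
pairCount : List ℕ → ℕ → ℕ
pairCount xs n = length (concatMap (λ x → concatMap (λ y →
  if (x <ᵇ y) ∧ (x + y ≡ᵇ n) then [ y ] else []) xs) xs)

-- ulamUpTo a b N = list of the terms of U(a,b) that are ≤ N (increasing order)
-- Assumes a < b. A number N > b is a term iff it is a sum of two distinct
-- earlier terms (all of which are < N) in exactly one way.
ulamStep : ℕ → ℕ → ℕ → List ℕ → List ℕ
ulamStep a b m prev =
  if (m ≡ᵇ a) ∨ (m ≡ᵇ b) ∨ ((b <ᵇ m) ∧ (pairCount prev m ≡ᵇ 1))
  then prev ++ [ m ] else prev

ulamUpTo : ℕ → ℕ → ℕ → List ℕ
ulamUpTo a b zero = []
ulamUpTo a b (suc N) = ulamStep a b (suc N) (ulamUpTo a b N)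

InUlam : ℕ → ℕ → ℕ → Set
InUlam a b n = n ∈ ulamUpTo a b n

{-# OPTIONS --safe #-}
-- Every term of U(a,b) other than a and b is a sum of two distinct earlier
-- terms, so by induction every term is a, b, or (i+1)a + (j+1)b with i, j ≥ 0.
-- If ka = (s+1)a + (t+1)b then (k-s-1)a = (t+1)b, and coprimality forces
-- b ∣ k-s-1, impossible for 0 < k-s-1 < k ≤ b; ka is neither a (k ≥ 2) nor b
-- (a ≠ 1). The case lb follows with the roles of a and b exchanged.
module Submission where

open import Defs
open import Data.Bool using (true; false; T; if_then_else_; _∧_; _∨_)
open import Data.Bool.Properties using (T-∧; T-∨)
open import Data.List using (List; []; _∷_; _++_; [_]; length)
open import Data.List.Membership.Propositional using (_∈_; find)
open import Data.List.Membership.Propositional.Properties using (∈-++⁻; ∈-concatMap⁻)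
open import Data.List.Relation.Unary.Any using (here)
open import Data.Nat using (ℕ; zero; suc; _<ᵇ_; _≡ᵇ_; _+_; _*_; _∸_; _<_; _≤_; z<s; >-nonZero)
open import Data.Nat.Properties
open import Data.Nat.Coprimality using (Coprime; gcd≡1⇒coprime; coprime-divisor)
import Data.Nat.Coprimality as Coprime
open import Data.Nat.Divisibility using (_∣_; divides; ∣-refl; ∣⇒≤)
open import Data.Nat.GCD using (gcd)
open import Data.Nat.Tactic.RingSolver using (solve-∀)
open import Data.Product using (_×_; _,_; ∃; ∃₂)
open import Data.Sum using (_⊎_; inj₁; inj₂)
open import Data.Empty using (⊥-elim)
open import Function using (_∘_; _$_)
open import Function.Bundles using (Equivalence)
open import Relation.Binary.PropositionalEquality using (_≡_; _≢_; refl; sym; trans; subst; cong)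
open import Relation.Nullary using (¬_)

data UlamForm (a b : ℕ) : ℕ → Set where
  gen-a : UlamForm a b a
  gen-b : UlamForm a b b
  mixed : ∀ i j → UlamForm a b (suc i * a + suc j * b)

mixed-≡ : ∀ {a b n} i j → n ≡ suc i * a + suc j * b → UlamForm a b n
mixed-≡ i j refl = mixed i j

UlamForm-swap : ∀ {a b n} → UlamForm a b n → UlamForm b a n
UlamForm-swap gen-a = gen-b
UlamForm-swap gen-b = gen-a
UlamForm-swap {a} {b} (mixed i j) = mixed-≡ j i (+-comm (suc i * a) (suc j * b))

private
  a+b≡mixed : ∀ a b → a + b ≡ 1 * a + 1 * b
  a+b≡mixed = solve-∀

  b+a≡mixed : ∀ a b → b + a ≡ 1 * a + 1 * b
  b+a≡mixed = solve-∀

  a+mixed≡mixed : ∀ a b i j → a + (suc i * a + suc j * b) ≡ suc (suc i) * a + suc j * b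
  a+mixed≡mixed = solve-∀

  b+mixed≡mixed : ∀ a b i j → b + (suc i * a + suc j * b) ≡ suc i * a + suc (suc j) * b
  b+mixed≡mixed = solve-∀

  mixed+mixed≡mixed : ∀ a b i j i′ j′ →
    (suc i * a + suc j * b) + (suc i′ * a + suc j′ * b) ≡ suc (suc (i + i′)) * a + suc (suc (j + j′)) * b
  mixed+mixed≡mixed = solve-∀

a+UlamForm : ∀ {a b y} → y ≢ a → UlamForm a b y → UlamForm a b (a + y)
a+UlamForm y≢a gen-a = ⊥-elim (y≢a refl)
a+UlamForm {a} {b} _ gen-b = mixed-≡ 0 0 (a+b≡mixed a b)
a+UlamForm {a} {b} _ (mixed i j) = mixed-≡ (suc i) j (a+mixed≡mixed a b i j)

b+UlamForm : ∀ {a b y} → y ≢ b → UlamForm a b y → UlamForm a b (b + y)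
b+UlamForm {a} {b} _ gen-a = mixed-≡ 0 0 (b+a≡mixed a b)
b+UlamForm y≢b gen-b = ⊥-elim (y≢b refl)
b+UlamForm {a} {b} _ (mixed i j) = mixed-≡ i (suc j) (b+mixed≡mixed a b i j)

mixed+UlamForm : ∀ {a b y} i j → UlamForm a b y → UlamForm a b (suc i * a + suc j * b + y)
mixed+UlamForm {a} {b} i j gen-a =
  mixed-≡ (suc i) j (trans (+-comm _ a) (a+mixed≡mixed a b i j))
mixed+UlamForm {a} {b} i j gen-b =
  mixed-≡ i (suc j) (trans (+-comm _ b) (b+mixed≡mixed a b i j))
mixed+UlamForm {a} {b} i j (mixed i′ j′) =
  mixed-≡ (suc (i + i′)) (suc (j + j′)) (mixed+mixed≡mixed a b i j i′ j′)

UlamForm-+ : ∀ {a b x y} → x ≢ y → UlamForm a b x → UlamForm a b y → UlamForm a b (x + y)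
UlamForm-+ x≢y gen-a = a+UlamForm (x≢y ∘ sym)
UlamForm-+ x≢y gen-b = b+UlamForm (x≢y ∘ sym)
UlamForm-+ _ (mixed i j) = mixed+UlamForm i j

nonempty⇒∈ : ∀ {A : Set} (zs : List A) → 0 < length zs → ∃ λ z → z ∈ zs
nonempty⇒∈ (z ∷ _) _ = z , here refl

∈-if-[]⇒T : ∀ {A : Set} c {y z : A} → z ∈ (if c then [ y ] else []) → T c
∈-if-[]⇒T true _ = _
∈-if-[]⇒T false ()

pairCount>0⇒pair : ∀ xs n → 0 < pairCount xs n →
                   ∃₂ λ x y → x ∈ xs × y ∈ xs × x < y × x + y ≡ n
pairCount>0⇒pair xs n count>0 =
  let z , z∈pairs = nonempty⇒∈ _ count>0
      x , x∈xs , z∈row = find (∈-concatMap⁻ _ z∈pairs)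
      y , y∈xs , z∈cell = find (∈-concatMap⁻ _ z∈row)
      x<ᵇy , x+y≡ᵇn = Equivalence.to T-∧ (∈-if-[]⇒T _ z∈cell)
  in x , y , x∈xs , y∈xs , <ᵇ⇒< x y x<ᵇy , ≡ᵇ⇒≡ (x + y) n x+y≡ᵇn

∈-if-++⁻ : ∀ {A : Set} c {xs : List A} {m x} → x ∈ (if c then xs ++ [ m ] else xs) →
           x ∈ xs ⊎ (x ≡ m × T c)
∈-if-++⁻ false x∈xs = inj₁ x∈xs
∈-if-++⁻ true {xs} x∈ with ∈-++⁻ xs x∈
... | inj₁ x∈xs = inj₁ x∈xs
... | inj₂ (here x≡m) = inj₂ (x≡m , _)

ulamStep-admits : ∀ a b m prev →
  T ((m ≡ᵇ a) ∨ (m ≡ᵇ b) ∨ ((b <ᵇ m) ∧ (pairCount prev m ≡ᵇ 1))) →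
  m ≡ a ⊎ m ≡ b ⊎ 0 < pairCount prev m
ulamStep-admits a b m prev admitted with Equivalence.to T-∨ admitted
... | inj₁ m≡ᵇa = inj₁ (≡ᵇ⇒≡ m a m≡ᵇa)
... | inj₂ rest with Equivalence.to T-∨ rest
...   | inj₁ m≡ᵇb = inj₂ (inj₁ (≡ᵇ⇒≡ m b m≡ᵇb))
...   | inj₂ unique =
  let _ , count≡ᵇ1 = Equivalence.to T-∧ unique
  in inj₂ (inj₂ (subst (0 <_) (sym (≡ᵇ⇒≡ (pairCount prev m) 1 count≡ᵇ1)) z<s))

∈-ulamStep⁻ : ∀ {a b m prev x} → x ∈ ulamStep a b m prev →
              x ∈ prev ⊎ (x ≡ m × (m ≡ a ⊎ m ≡ b ⊎ 0 < pairCount prev m))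
∈-ulamStep⁻ {a} {b} {m} {prev} x∈ with ∈-if-++⁻ _ x∈
... | inj₁ x∈prev = inj₁ x∈prev
... | inj₂ (x≡m , admitted) = inj₂ (x≡m , ulamStep-admits a b m prev admitted)

∈-ulamUpTo⇒UlamForm : ∀ {a b} N {x} → x ∈ ulamUpTo a b N → UlamForm a b x
∈-ulamUpTo⇒UlamForm zero ()
∈-ulamUpTo⇒UlamForm {a} {b} (suc N) x∈ with ∈-ulamStep⁻ {a} {b} {suc N} {ulamUpTo a b N} x∈
... | inj₁ x∈prev = ∈-ulamUpTo⇒UlamForm N x∈prev
... | inj₂ (refl , inj₁ refl) = gen-a
... | inj₂ (refl , inj₂ (inj₁ refl)) = gen-b
... | inj₂ (refl , inj₂ (inj₂ count>0)) =
  let y , z , y∈ , z∈ , y<z , y+z≡x = pairCount>0⇒pair _ _ count>0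
  in subst (UlamForm _ _) y+z≡x
       (UlamForm-+ (<⇒≢ y<z) (∈-ulamUpTo⇒UlamForm N y∈) (∈-ulamUpTo⇒UlamForm N z∈))

InUlam⇒UlamForm : ∀ {a b n} → InUlam a b n → UlamForm a b n
InUlam⇒UlamForm {n = n} = ∈-ulamUpTo⇒UlamForm n

multiple≢mixed : ∀ {p q} k s t → 0 < q → Coprime q p → k ≤ q → k * p ≢ suc s * p + suc t * q
multiple≢mixed {p} {q} k s t 0<q q⊥p k≤q kp≡mixed = <-irrefl refl $ begin-strict
  q  ≤⟨ ∣⇒≤ {{>-nonZero 0<d}} (coprime-divisor q⊥p q∣p*d) ⟩
  d  <⟨ m<m+n d z<s ⟩
  d + suc s  ≡⟨ d+s+1≡k ⟩
  k  ≤⟨ k≤q ⟩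
  q  ∎
  where
  open ≤-Reasoning
  s+1<k : suc s < k
  s+1<k = *-cancelʳ-< p (suc s) k $ begin-strict
    suc s * p                  <⟨ m<m+n (suc s * p) (<-≤-trans 0<q (m≤m+n q (t * q))) ⟩
    suc s * p + suc t * q      ≡⟨ sym kp≡mixed ⟩
    k * p                      ∎
  d : ℕ
  d = k ∸ suc s
  0<d : 0 < d
  0<d = m<n⇒0<n∸m s+1<k
  d+s+1≡k : d + suc s ≡ k
  d+s+1≡k = m∸n+n≡m (<⇒≤ s+1<k)
  d*p≡t+1*q : d * p ≡ suc t * q
  d*p≡t+1*q = +-cancelʳ-≡ (suc s * p) (d * p) (suc t * q) $ begin-equality
    d * p + suc s * p      ≡⟨ *-distribʳ-+ p d (suc s) ⟨
    (d + suc s) * p        ≡⟨ cong (_* p) d+s+1≡k ⟩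
    k * p                  ≡⟨ kp≡mixed ⟩
    suc s * p + suc t * q  ≡⟨ +-comm (suc s * p) (suc t * q) ⟩
    suc t * q + suc s * p  ∎
  q∣p*d : q ∣ p * d
  q∣p*d = divides (suc t) (trans (*-comm p d) d*p≡t+1*q)

multiple∉UlamForm : ∀ {p q k} → 0 < p → 0 < q → Coprime q p → 2 ≤ k → k ≤ q → k * p ≢ q →
                    ¬ UlamForm p q (k * p)
multiple∉UlamForm {p} {q} {k} 0<p 0<q q⊥p 2≤k k≤q kp≢q form = multiple≢form form refl
  where
  multiple≢form : ∀ {n} → UlamForm p q n → k * p ≢ n
  multiple≢form gen-a kp≡p =
    <-irrefl (sym kp≡p) (subst (p <_) (*-comm p k) (m<m*n p k {{>-nonZero 0<p}} 2≤k))
  multiple≢form gen-b = kp≢q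
  multiple≢form (mixed s t) = multiple≢mixed k s t 0<q q⊥p k≤q

lemma5p6 : (a b : ℕ) → 0 < a → a < b → gcd a b ≡ 1 → a ≢ 1 →
           (k l : ℕ) → 2 ≤ k → k ≤ b → 2 ≤ l → l ≤ a →
           ¬ InUlam a b (k * a) × ¬ InUlam a b (l * b)
lemma5p6 a b 0<a a<b gcd≡1 a≢1 k l 2≤k k≤b 2≤l l≤a =
    (λ ka∈U → multiple∉UlamForm 0<a 0<b b⊥a 2≤k k≤b ka≢b (InUlam⇒UlamForm ka∈U))
  , (λ lb∈U → multiple∉UlamForm 0<b 0<a a⊥b 2≤l l≤a lb≢a
                (UlamForm-swap (InUlam⇒UlamForm lb∈U)))
  where
  0<b : 0 < b
  0<b = <-trans 0<a a<b
  a⊥b : Coprime a b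
  a⊥b = gcd≡1⇒coprime gcd≡1
  b⊥a : Coprime b a
  b⊥a = Coprime.sym a⊥b
  ka≢b : k * a ≢ b
  ka≢b ka≡b = a≢1 (a⊥b (∣-refl , divides k (sym ka≡b)))
  lb≢a : l * b ≢ a
  lb≢a lb≡a = <-irrefl (sym lb≡a) (<-≤-trans a<b (m≤n*m b l {{>-nonZero (<-trans z<s 2≤l)}}))
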